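{- Let $G=\mathcal G[a_1,\ldots,a_n]$ with $a_1>1$ and $a_n>1$. - If $n$ is even, then each of the two band graphs arising from $G$ glues exactly one dominant edge. - If $n$ is odd, then one band graph arising from $G$ glues neither dominant edge and the other glues both dominant edges.
   Context: Snake graphs. A snake graph $G=(G_1,\ldots,G_d)$ is a sequence of unit square tiles, each $G_{i+1}$ glued to $G_i$ along $N(G_i)$ or $E(G_i)$ (north/east edges; $S,W$ are south/west). Sign functions and $\mathcal G[a_1,\ldots,a_n]$. A sign function labels edges by $\pm$ so that in every tile south and east agree, north and west agree, and north and south differ, with $S(G_1)$ labelled $-$. The sign sequence is $(f_1,\ldots,f_{d+1})$: $f_1$ is the sign of $S(G_1)$, $f_{i+1}$ is the sign of the edge shared by $G_i,G_{i+1}$, and $f_{d+1}=f_d$. $\mathcal G[a_1,\ldots,a_n]$ is the unique snake graph whose sign sequence has maximal equal-sign blocks of lengths $a_1,\ldots,a_n$. Matchings and dominant edges. Boundary edges lie on only one tile. The minimal matching is the perfect matching of boundary edges only that contains $S(G_1)$; the maximal matching is the other perfect matching of boundary edges only. The dominant edge of $G_1$ is the edge in $\{S(G_1),W(G_1)\}$ whose endpoints are incident only to $G_1$. The dominant edge of $G_d$ is the edge in $\{N(G_d),E(G_d)\}$ whose endpoints are incident only to $G_d$. Band graphs. A band graph arising from $G$ is formed by identifying an edge $e\in\{S(G_1),W(G_1)\}$ with an edge $e'\in\{N(G_d),E(G_d)\}$ such that $e$ is in the minimal matching if and only if $e'$ is not. There are two band graphs arising from $G$. -}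

module Defs where

open import Data.Nat using (ℕ; zero; suc; _+_)
open import Data.Bool using (Bool; true; false)
open import Data.List using (List; []; _∷_; length)
open import Data.Fin using (Fin; fromℕ; toℕ)
open import Data.Product using (Σ; _×_; _,_; proj₁; proj₂)
open import Data.Sum using (_⊎_)
open import Relation.Binary.PropositionalEquality using (_≡_)

-- Direction in which tile G_{i+1} is glued to G_i: along N(G_i) or E(G_i).
data Dir : Set where
  N E : Dir

-- A snake graph with d tiles G_1,...,G_d is given by the list of its
-- d-1 gluing directions.  Its tiles are indexed by Fin (suc (length ds)),
-- index 0 being G_1.
Snake : Set
Snake = List Dir

numTiles : Snake → ℕ
numTiles ds = suc (length ds)

Point : Set
Point = ℕ × ℕ

-- lower-left corner of the tile with index i (G_1 sits at (0,0))
tileAt : Snake → ℕ → Point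
tileAt _        zero    = (0 , 0)
tileAt []       (suc i) = (0 , 0)
tileAt (N ∷ ds) (suc i) = (proj₁ (tileAt ds i) , suc (proj₂ (tileAt ds i)))
tileAt (E ∷ ds) (suc i) = (suc (proj₁ (tileAt ds i)) , proj₂ (tileAt ds i))

tile : (G : Snake) → Fin (numTiles G) → Point
tile G i = tileAt G (toℕ i)

firstTile : (G : Snake) → Fin (numTiles G)
firstTile G = Fin.zero

lastTile : (G : Snake) → Fin (numTiles G)
lastTile G = fromℕ (length G)

-- Unit edges of the lattice: hor x y = segment (x,y)-(x+1,y),
-- ver x y = segment (x,y)-(x,y+1).
data Edge : Set where
  hor ver : ℕ → ℕ → Edge

S-of N-of W-of E-of : Point → Edge
S-of (x , y) = hor x y
N-of (x , y) = hor x (suc y)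
W-of (x , y) = ver x y
E-of (x , y) = ver (suc x) y

OnTile : Edge → Point → Set
OnTile e p = e ≡ S-of p ⊎ e ≡ N-of p ⊎ e ≡ W-of p ⊎ e ≡ E-of p

Corner : Point → Point → Set
Corner v (x , y) = v ≡ (x , y) ⊎ v ≡ (suc x , y) ⊎ v ≡ (x , suc y) ⊎ v ≡ (suc x , suc y)

Incident : Point → Edge → Set
Incident v (hor x y) = v ≡ (x , y) ⊎ v ≡ (suc x , y)
Incident v (ver x y) = v ≡ (x , y) ⊎ v ≡ (x , suc y)

IsVertex : Snake → Point → Set
IsVertex G v = Σ (Fin (numTiles G)) λ i → Corner v (tile G i)

IsBoundary : Snake → Edge → Set
IsBoundary G e = Σ (Fin (numTiles G)) λ i →
  OnTile e (tile G i) × (∀ j → OnTile e (tile G j) → j ≡ i)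

EdgeSet : Set
EdgeSet = Edge → Bool

IsBoundaryPerfectMatching : Snake → EdgeSet → Set
IsBoundaryPerfectMatching G M =
  (∀ e → M e ≡ true → IsBoundary G e) ×
  (∀ v → IsVertex G v → Σ Edge λ e → M e ≡ true × Incident v e ×
      (∀ e' → M e' ≡ true → Incident v e' → e' ≡ e))

IsMinimalMatching : Snake → EdgeSet → Set
IsMinimalMatching G M =
  IsBoundaryPerfectMatching G M × M (S-of (tile G (firstTile G))) ≡ true

DominantFirst : Snake → Edge → Set
DominantFirst G e =
  (e ≡ S-of (tile G (firstTile G)) ⊎ e ≡ W-of (tile G (firstTile G))) ×
  (∀ v → Incident v e → ∀ j → Corner v (tile G j) → j ≡ firstTile G)

DominantLast : Snake → Edge → Set
DominantLast G e =
  (e ≡ N-of (tile G (lastTile G)) ⊎ e ≡ E-of (tile G (lastTile G))) ×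
  (∀ v → Incident v e → ∀ j → Corner v (tile G j) → j ≡ lastTile G)

-- The band graph obtained by identifying e with e' (M = minimal matching):
-- e ∈ {S(G_1),W(G_1)}, e' ∈ {N(G_d),E(G_d)}, and e ∈ M iff e' ∉ M.
IsBandGluing : Snake → EdgeSet → Edge → Edge → Set
IsBandGluing G M e e' =
  (e ≡ S-of (tile G (firstTile G)) ⊎ e ≡ W-of (tile G (firstTile G))) ×
  (e' ≡ N-of (tile G (lastTile G)) ⊎ e' ≡ E-of (tile G (lastTile G))) ×
  ((M e ≡ true → M e' ≡ false) × (M e' ≡ false → M e ≡ true))

data Sign : Set where
  plus minus : Sign

neg : Sign → Sign
neg plus  = minus
neg minus = plus

_==ˢ_ : Sign → Sign → Bool
plus  ==ˢ plus  = true
minus ==ˢ minus = true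
_     ==ˢ _     = false

-- The sign function: in every tile, sign(E) = sign(S), sign(N) = sign(W),
-- sign(N) = neg sign(S).  So it is determined by the sign of S(G_i):
--   sign S(G_1) = minus;
--   if G_{i+1} is glued along N(G_i) = S(G_{i+1}),
--     sign S(G_{i+1}) = sign N(G_i) = neg (sign S(G_i));
--   if G_{i+1} is glued along E(G_i) = W(G_{i+1}),
--     sign W(G_{i+1}) = sign E(G_i) = sign S(G_i), so
--     sign S(G_{i+1}) = neg (sign S(G_i)).
-- Sign of the shared edge of G_i and G_{i+1}:
sharedSign : Dir → Sign → Sign      -- direction, sign of S(G_i)
sharedSign N s = neg s               -- sign N(G_i)
sharedSign E s = s                   -- sign E(G_i)

nextS : Dir → Sign → Sign            -- sign of S(G_{i+1}) from sign S(G_i)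
nextS N s = sharedSign N s           -- S(G_{i+1}) = N(G_i)
nextS E s = neg (sharedSign E s)     -- W(G_{i+1}) = E(G_i), S = neg W

-- f_{i+1},...,f_{d+1} given sign S(G_i) = s, f_i = f, and the remaining directions
signTail : Sign → Sign → List Dir → List Sign
signTail s f []         = f ∷ []                       -- f_{d+1} = f_d
signTail s f (dr ∷ ds)  = sharedSign dr s ∷ signTail (nextS dr s) (sharedSign dr s) ds

-- (f_1,...,f_{d+1}), with f_1 = sign S(G_1) = minus
signSeq : Snake → List Sign
signSeq G = minus ∷ signTail minus minus G

runsFrom : Sign → ℕ → List Sign → List ℕ
runsFrom x k []       = k ∷ []
runsFrom x k (y ∷ ys) with x ==ˢ y
... | true  = runsFrom x (suc k) ys
... | false = k ∷ runsFrom y 1 ys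

blockLengths : List Sign → List ℕ
blockLengths []       = []
blockLengths (x ∷ xs) = runsFrom x 1 xs

IsSnakeOf : Snake → List ℕ → Set
IsSnakeOf G as = blockLengths (signSeq G) ≡ as

{-# OPTIONS --safe #-}
module Submission where

-- Since a₁ > 1, G₂ is glued east of G₁: then W(G₁) is the dominant edge of G₁ and S(G₁) is not,
-- while the minimal matching M contains S(G₁) but not W(G₁).  The dominant edge of G_d is the one
-- on the side of the last gluing.  Along the walk S(G₁), …, E(G_d) on the south-east boundary each
-- two consecutive edges are the only boundary edges at their common vertex, so M alternates along
-- it; hence whether E(G_d) and N(G_d) lie in M depends only on the parity of d.  The signs of the
-- S(G_i) alternate as well, so the parity of the number n of sign blocks (n is odd iff f_{d+1} = f_1)
-- is determined by d and the last gluing direction.  Comparing both: the dominant edge of G_d lies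
-- in M iff n is odd.  A band gluing pairs an edge of M with one outside M, so for n even S(G₁)
-- meets the dominant and W(G₁) the non-dominant edge of G_d, and for n odd the other way round.

open import Defs
open import Data.Nat using (ℕ; zero; suc; _<_; _≤_; _%_; z≤n; s≤s)
open import Data.Nat.Properties
  using (≤-refl; ≤-reflexive; ≤-trans; n≤1+n; 1+n≰n; ≤-pred; _≤?_; ≰⇒>; m≤n⇒m<n∨m≡n)
open import Data.Bool using (Bool; true; false; not)
open import Data.Bool.Properties using (not-involutive)
open import Data.List using (List; []; _∷_; length; head; last)
open import Data.Maybe using (just)
open import Data.Fin using (Fin; toℕ; fromℕ<) renaming (zero to fzero; suc to fsuc)
open import Data.Fin.Properties using (toℕ-fromℕ; toℕ-fromℕ<; toℕ-injective; toℕ≤pred[n])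
open import Data.Product using (Σ; _×_; _,_; proj₁; proj₂)
open import Data.Sum using (_⊎_; inj₁; inj₂)
open import Data.Empty using (⊥-elim)
open import Function using (_∘_)
open import Relation.Nullary using (¬_; yes; no; contradiction)
open import Relation.Binary.PropositionalEquality
open ≡-Reasoning

move : Dir → Point → Point
move N (x , y) = (x , suc y)
move E (x , y) = (suc x , y)

move-comm : ∀ d d′ p → move d (move d′ p) ≡ move d′ (move d p)
move-comm N N p = refl
move-comm N E p = refl
move-comm E N p = refl
move-comm E E p = refl

lowerRight upperRight : Point → Point
lowerRight (x , y) = (suc x , y)
upperRight (x , y) = (suc x , suc y)

tileAt-∷ : ∀ d ds i → tileAt (d ∷ ds) (suc i) ≡ move d (tileAt ds i)
tileAt-∷ N ds i = refl
tileAt-∷ E ds i = refl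

dirAt : Snake → ℕ → Dir
dirAt []       _       = N
dirAt (d ∷ ds) zero    = d
dirAt (d ∷ ds) (suc i) = dirAt ds i

dirAt-length : ∀ G → dirAt G (length G) ≡ N
dirAt-length []       = refl
dirAt-length (d ∷ ds) = dirAt-length ds

dirAt≡E⇒< : ∀ G i → dirAt G i ≡ E → i < length G
dirAt≡E⇒< (d ∷ ds) zero    _  = s≤s z≤n
dirAt≡E⇒< (d ∷ ds) (suc i) eq = s≤s (dirAt≡E⇒< ds i eq)

tileAt-suc : ∀ G i → i < length G → tileAt G (suc i) ≡ move (dirAt G i) (tileAt G i)
tileAt-suc (d ∷ ds) zero    _       = tileAt-∷ d ds zero
tileAt-suc (d ∷ ds) (suc i) (s≤s h) = begin
  tileAt (d ∷ ds) (suc (suc i))               ≡⟨ tileAt-∷ d ds (suc i) ⟩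
  move d (tileAt ds (suc i))                  ≡⟨ cong (move d) (tileAt-suc ds i h) ⟩
  move d (move (dirAt ds i) (tileAt ds i))    ≡⟨ move-comm d (dirAt ds i) (tileAt ds i) ⟩
  move (dirAt ds i) (move d (tileAt ds i))    ≡⟨ cong (move (dirAt ds i)) (tileAt-∷ d ds i) ⟨
  move (dirAt ds i) (tileAt (d ∷ ds) (suc i)) ∎

tileAt-next : ∀ G {i d p} → i < length G → dirAt G i ≡ d → tileAt G i ≡ p →
  tileAt G (suc i) ≡ move d p
tileAt-next G {i} h refl refl = tileAt-suc G i h

_≼_ : Point → Point → Set
p ≼ q = proj₁ p ≤ proj₁ q × proj₂ p ≤ proj₂ q

≼-trans : ∀ {p q r} → p ≼ q → q ≼ r → p ≼ r
≼-trans (x≤ , y≤) (x≤′ , y≤′) = ≤-trans x≤ x≤′ , ≤-trans y≤ y≤′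

≼-respˡ : ∀ {p q r} → q ≡ p → q ≼ r → p ≼ r
≼-respˡ refl q≼r = q≼r

≼-respʳ : ∀ {p q r} → p ≼ q → q ≡ r → p ≼ r
≼-respʳ p≼q refl = p≼q

upperRight-mono : ∀ {p q} → p ≼ q → upperRight p ≼ upperRight q
upperRight-mono (x≤ , y≤) = s≤s x≤ , s≤s y≤

tileAt-mono : ∀ G {i k} → i ≤ k → tileAt G i ≼ tileAt G k
tileAt-mono G        {zero}          _       = z≤n , z≤n
tileAt-mono []       {suc i} {suc k} _       = z≤n , z≤n
tileAt-mono (N ∷ ds) {suc i} {suc k} (s≤s h) =
  proj₁ (tileAt-mono ds h) , s≤s (proj₂ (tileAt-mono ds h))
tileAt-mono (E ∷ ds) {suc i} {suc k} (s≤s h) =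
  s≤s (proj₁ (tileAt-mono ds h)) , proj₂ (tileAt-mono ds h)

tileAt-split : ∀ G i k → tileAt G k ≼ tileAt G i ⊎ (i < k × tileAt G (suc i) ≼ tileAt G k)
tileAt-split G i k with k ≤? i
... | yes k≤i = inj₁ (tileAt-mono G k≤i)
... | no  k≰i = inj₂ (≰⇒> k≰i , tileAt-mono G (≰⇒> k≰i))

corner-bounds : ∀ {v} p → Corner v p → p ≼ v × v ≼ upperRight p
corner-bounds p (inj₁ refl)               = (≤-refl , ≤-refl) , (n≤1+n _ , n≤1+n _)
corner-bounds p (inj₂ (inj₁ refl))        = (n≤1+n _ , ≤-refl) , (≤-refl , n≤1+n _)
corner-bounds p (inj₂ (inj₂ (inj₁ refl))) = (≤-refl , n≤1+n _) , (n≤1+n _ , ≤-refl)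
corner-bounds p (inj₂ (inj₂ (inj₂ refl))) = (n≤1+n _ , n≤1+n _) , (≤-refl , ≤-refl)

incident-hor : ∀ {v a b} → Incident v (hor a b) → proj₂ v ≡ b
incident-hor (inj₁ refl) = refl
incident-hor (inj₂ refl) = refl

incident-ver : ∀ {v a b} → Incident v (ver a b) → proj₁ v ≡ a
incident-ver (inj₁ refl) = refl
incident-ver (inj₂ refl) = refl

hor-on-tile : ∀ {a b} p → OnTile (hor a b) p → a ≡ proj₁ p × proj₂ p ≤ b
hor-on-tile p (inj₁ refl)                = refl , ≤-refl
hor-on-tile p (inj₂ (inj₁ refl))         = refl , n≤1+n _
hor-on-tile p (inj₂ (inj₂ (inj₁ ())))
hor-on-tile p (inj₂ (inj₂ (inj₂ ())))

ver-on-tile : ∀ {a b} p → OnTile (ver a b) p → b ≡ proj₂ p × a ≤ suc (proj₁ p)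
ver-on-tile p (inj₁ ())
ver-on-tile p (inj₂ (inj₁ ()))
ver-on-tile p (inj₂ (inj₂ (inj₁ refl))) = refl , n≤1+n _
ver-on-tile p (inj₂ (inj₂ (inj₂ refl))) = refl , ≤-refl

tileIndex : ∀ G {i} → i ≤ length G → Fin (numTiles G)
tileIndex G h = fromℕ< (s≤s h)

toℕ-tileIndex : ∀ G {i} (h : i ≤ length G) → toℕ (tileIndex G h) ≡ i
toℕ-tileIndex G h = toℕ-fromℕ< (s≤s h)

tile-tileIndex : ∀ G {i} (h : i ≤ length G) → tile G (tileIndex G h) ≡ tileAt G i
tile-tileIndex G h = cong (tileAt G) (toℕ-tileIndex G h)

isVertex-corner : ∀ G {i v} → i ≤ length G → Corner v (tileAt G i) → IsVertex G v
isVertex-corner G {v = v} h c = tileIndex G h , subst (Corner v) (sym (tile-tileIndex G h)) c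

boundaryTile : ∀ G {e} → IsBoundary G e → Σ ℕ λ k → k ≤ length G × OnTile e (tileAt G k)
boundaryTile G (j , on-j , _) = toℕ j , toℕ≤pred[n] j , on-j

boundary-tile-unique : ∀ G {e i k} → IsBoundary G e → i ≤ length G → k ≤ length G →
  OnTile e (tileAt G i) → OnTile e (tileAt G k) → i ≡ k
boundary-tile-unique G {e} {i} {k} (j , _ , unique) hi hk on-i on-k = begin
  i                    ≡⟨ toℕ-tileIndex G hi ⟨
  toℕ (tileIndex G hi) ≡⟨ cong toℕ (trans (unique _ (on hi on-i)) (sym (unique _ (on hk on-k)))) ⟩
  toℕ (tileIndex G hk) ≡⟨ toℕ-tileIndex G hk ⟩
  k                    ∎
  where
  on : ∀ {l} (h : l ≤ length G) → OnTile e (tileAt G l) → OnTile e (tile G (tileIndex G h))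
  on h = subst (OnTile e) (sym (tile-tileIndex G h))

shared-not-boundary : ∀ G {e i} → suc i ≤ length G →
  OnTile e (tileAt G i) → OnTile e (tileAt G (suc i)) → ¬ IsBoundary G e
shared-not-boundary G {i = i} h on-i on-i+1 b =
  1+n≰n (≤-reflexive (sym (boundary-tile-unique G b (≤-trans (n≤1+n i) h) h on-i on-i+1)))

-- The south-east boundary walk

-- lowerEdge G 0, lowerEdge G 1, … walk along the south-east boundary from (0,0):
-- lowerEdge G i and lowerEdge G (suc i) meet at the lower-right corner of tile i,
-- and since dirAt defaults to N the walk ends with E(G_d).
edgeFrom : Dir → Point → Edge
edgeFrom N p = E-of p
edgeFrom E p = S-of (move E p)

lowerEdge : Snake → ℕ → Edge
lowerEdge G zero    = S-of (0 , 0)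
lowerEdge G (suc i) = edgeFrom (dirAt G i) (tileAt G i)

module _ (G : Snake) where

  private
    LowerEdgeAt : ℕ → Edge → Set
    LowerEdgeAt i e = e ≡ lowerEdge G i ⊎ e ≡ lowerEdge G (suc i)

  left-boundary : ∀ {i x y} → i ≤ length G → tileAt G i ≡ (x , y) →
    IsBoundary G (hor x y) → LowerEdgeAt i (hor x y)
  left-boundary {zero}  _ refl _ = inj₁ refl
  left-boundary {suc j} h hx b with dirAt G j in d≡
  ... | E = inj₁ (cong S-of (trans (sym hx) (tileAt-next G h d≡ refl)))
  ... | N = ⊥-elim (shared-not-boundary G h
              (inj₂ (inj₁ (cong S-of (trans (sym hx) (tileAt-next G h d≡ refl)))))
              (inj₁ (cong S-of (sym hx))) b)

  up-boundary : ∀ {i x y} → i ≤ length G → tileAt G i ≡ (x , y) →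
    IsBoundary G (ver (suc x) y) → LowerEdgeAt i (ver (suc x) y)
  up-boundary {i} h hx b with dirAt G i in d≡
  ... | N = inj₂ (cong E-of (sym hx))
  ... | E = ⊥-elim (shared-not-boundary G i<
              (inj₂ (inj₂ (inj₂ (cong E-of (sym hx)))))
              (inj₂ (inj₂ (inj₁ (cong W-of (sym (tileAt-next G i< d≡ hx)))))) b)
    where i< = dirAt≡E⇒< G i d≡

  right-boundary : ∀ {i x y} → i ≤ length G → tileAt G i ≡ (x , y) →
    IsBoundary G (hor (suc x) y) → LowerEdgeAt i (hor (suc x) y)
  right-boundary {i} {x} h hx b with dirAt G i in d≡
  ... | E = inj₂ (cong (edgeFrom E) (sym hx))
  ... | N with boundaryTile G b
  ... | k , k≤ , on-k with hor-on-tile (tileAt G k) on-k | tileAt-split G i k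
  ... | x+1≡ , _ | inj₁ k≼i =
    ⊥-elim (1+n≰n (subst (_≤ x) (sym x+1≡) (proj₁ (≼-respʳ k≼i hx))))
  ... | _ , ky≤y | inj₂ (i<k , i+1≼k) =
    ⊥-elim (1+n≰n (≤-trans (proj₂ (≼-respˡ i+1≡ i+1≼k)) ky≤y))
    where i+1≡ = tileAt-next G (≤-trans i<k k≤) d≡ hx

  down-boundary : ∀ {i x q} → i ≤ length G → tileAt G i ≡ (x , suc q) →
    IsBoundary G (ver (suc x) q) → LowerEdgeAt i (ver (suc x) q)
  down-boundary {zero}  _ () _
  down-boundary {suc j} h hx b with dirAt G j in d≡
  ... | N with trans (sym (tileAt-next G h d≡ refl)) hx
  ...   | refl = inj₁ refl
  down-boundary {suc j} {q = q} h hx b | E with boundaryTile G b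
  ... | k , k≤ , on-k with ver-on-tile (tileAt G k) on-k | tileAt-split G j k
  ... | _ , x≤ | inj₁ k≼j =
    ⊥-elim (1+n≰n (subst (_≤ proj₁ (tileAt G j)) (sym x≡) (≤-trans (≤-pred x≤) (proj₁ k≼j))))
    where x≡ = cong proj₁ (trans (sym (tileAt-next G h d≡ refl)) hx)
  ... | q≡ , _ | inj₂ (_ , j+1≼k) =
    ⊥-elim (1+n≰n (subst (suc q ≤_) (sym q≡) (proj₂ (≼-respˡ hx j+1≼k))))

  lowerRight-boundary : ∀ {i} → i ≤ length G → ∀ {e} → IsBoundary G e →
    Incident (lowerRight (tileAt G i)) e → LowerEdgeAt i e
  lowerRight-boundary h b inc = at h refl b inc
    where
    at : ∀ {i x y} → i ≤ length G → tileAt G i ≡ (x , y) →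
      ∀ {e} → IsBoundary G e → Incident (suc x , y) e → LowerEdgeAt i e
    at h hx {hor _ _} b (inj₁ refl) = right-boundary h hx b
    at h hx {hor _ _} b (inj₂ refl) = left-boundary h hx b
    at h hx {ver _ _} b (inj₁ refl) = up-boundary h hx b
    at h hx {ver _ _} b (inj₂ refl) = down-boundary h hx b

upperRight-last-boundary : ∀ G {x y} → tileAt G (length G) ≡ (x , y) →
  ∀ {e} → IsBoundary G e → Incident (suc x , suc y) e → e ≡ E-of (x , y) ⊎ e ≡ N-of (x , y)
upperRight-last-boundary G {x} hx {hor _ _} b (inj₁ refl) with boundaryTile G b
... | k , k≤ , on-k = ⊥-elim (1+n≰n (subst (_≤ x) (sym (proj₁ (hor-on-tile _ on-k)))
                                   (proj₁ (≼-respʳ (tileAt-mono G k≤) hx))))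
upperRight-last-boundary G hx {hor _ _} b (inj₂ refl) = inj₂ refl
upperRight-last-boundary G {y = y} hx {ver _ _} b (inj₁ refl) with boundaryTile G b
... | k , k≤ , on-k = ⊥-elim (1+n≰n (subst (_≤ y) (sym (proj₁ (ver-on-tile _ on-k)))
                                   (proj₂ (≼-respʳ (tileAt-mono G k≤) hx))))
upperRight-last-boundary G hx {ver _ _} b (inj₂ refl) = inj₁ refl

-- Boundary perfect matchings

source target : Edge → Point
source (hor x y) = (x , y)
source (ver x y) = (x , y)
target (hor x y) = (suc x , y)
target (ver x y) = (x , suc y)

source-incident : ∀ e → Incident (source e) e
source-incident (hor x y) = inj₁ refl
source-incident (ver x y) = inj₁ refl

target-incident : ∀ e → Incident (target e) e
target-incident (hor x y) = inj₂ refl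
target-incident (ver x y) = inj₂ refl

source≢target : ∀ e → source e ≢ target e
source≢target (hor x y) eq = 1+n≰n (≤-reflexive (sym (cong proj₁ eq)))
source≢target (ver x y) eq = 1+n≰n (≤-reflexive (sym (cong proj₂ eq)))

matched-one-of-two : ∀ {G M v e₁ e₂} → IsBoundaryPerfectMatching G M → IsVertex G v →
  Incident v e₁ → Incident v e₂ → e₁ ≢ e₂ →
  (∀ {e} → IsBoundary G e → Incident v e → e ≡ e₁ ⊎ e ≡ e₂) →
  M e₂ ≡ not (M e₁)
matched-one-of-two {M = M} {v} {e₁} {e₂} (boundary , covered) vertex inc₁ inc₂ e₁≢e₂ only
  with covered v vertex | M e₁ in m₁ | M e₂ in m₂
... | _ | true  | false = refl
... | _ | false | true  = refl
... | _ , _ , _ , unique | true | true =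
  ⊥-elim (e₁≢e₂ (trans (unique e₁ m₁ inc₁) (sym (unique e₂ m₂ inc₂))))
... | e , Me , inc , _ | false | false with only (boundary e Me) inc
...   | inj₁ refl = contradiction (trans (sym Me) m₁) λ ()
...   | inj₂ refl = contradiction (trans (sym Me) m₂) λ ()

source-edgeFrom : ∀ d p → source (edgeFrom d p) ≡ lowerRight p
source-edgeFrom N p = refl
source-edgeFrom E p = refl

target-edgeFrom : ∀ d p → target (edgeFrom d p) ≡ lowerRight (move d p)
target-edgeFrom N p = refl
target-edgeFrom E p = refl

target-lowerEdge : ∀ G i → i ≤ length G → target (lowerEdge G i) ≡ lowerRight (tileAt G i)
target-lowerEdge G zero    _ = refl
target-lowerEdge G (suc j) h =
  trans (target-edgeFrom (dirAt G j) (tileAt G j)) (cong lowerRight (sym (tileAt-suc G j h)))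

lowerEdge-alternates : ∀ G {M} → IsBoundaryPerfectMatching G M →
  ∀ i → i ≤ length G → M (lowerEdge G (suc i)) ≡ not (M (lowerEdge G i))
lowerEdge-alternates G pm i h =
  matched-one-of-two pm (isVertex-corner G h (inj₂ (inj₁ refl))) incoming outgoing distinct
    (lowerRight-boundary G h)
  where
  incoming : Incident (lowerRight (tileAt G i)) (lowerEdge G i)
  incoming = subst (λ v → Incident v (lowerEdge G i)) (target-lowerEdge G i h) (target-incident _)
  outgoing : Incident (lowerRight (tileAt G i)) (lowerEdge G (suc i))
  outgoing = subst (λ v → Incident v (lowerEdge G (suc i)))
    (source-edgeFrom (dirAt G i) (tileAt G i)) (source-incident _)
  distinct : lowerEdge G i ≢ lowerEdge G (suc i)
  distinct eq = source≢target (lowerEdge G (suc i)) (begin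
    source (lowerEdge G (suc i)) ≡⟨ source-edgeFrom (dirAt G i) (tileAt G i) ⟩
    lowerRight (tileAt G i)      ≡⟨ target-lowerEdge G i h ⟨
    target (lowerEdge G i)       ≡⟨ cong target eq ⟩
    target (lowerEdge G (suc i)) ∎)

even : ℕ → Bool
even zero    = true
even (suc n) = not (even n)

n%2≡0⇒even : ∀ n → n % 2 ≡ 0 → even n ≡ true
n%2≡0⇒even zero          _ = refl
n%2≡0⇒even (suc (suc n)) h = trans (not-involutive (even n)) (n%2≡0⇒even n h)

n%2≡1⇒odd : ∀ n → n % 2 ≡ 1 → even n ≡ false
n%2≡1⇒odd (suc zero)    _ = refl
n%2≡1⇒odd (suc (suc n)) h = trans (not-involutive (even n)) (n%2≡1⇒odd n h)

lowerEdge-matched : ∀ G {M} → IsBoundaryPerfectMatching G M → M (S-of (0 , 0)) ≡ true →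
  ∀ i → i ≤ suc (length G) → M (lowerEdge G i) ≡ even i
lowerEdge-matched G pm m₀ zero    _ = m₀
lowerEdge-matched G pm m₀ (suc i) h =
  trans (lowerEdge-alternates G pm i (≤-pred h))
        (cong not (lowerEdge-matched G pm m₀ i (≤-trans (n≤1+n i) h)))

module _ (G : Snake) {M : EdgeSet} (pm : IsBoundaryPerfectMatching G M)
         (m₀ : M (S-of (0 , 0)) ≡ true) where

  private
    L = length G
    lastP = tileAt G L

  E-lastTile-matched : M (E-of lastP) ≡ not (even L)
  E-lastTile-matched = subst (λ d → M (edgeFrom d lastP) ≡ not (even L)) (dirAt-length G)
    (lowerEdge-matched G pm m₀ (suc L) ≤-refl)

  N-lastTile-matched : M (N-of lastP) ≡ even L
  N-lastTile-matched = begin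
    M (N-of lastP)       ≡⟨ matched-one-of-two pm (isVertex-corner G ≤-refl (inj₂ (inj₂ (inj₂ refl))))
                              (inj₂ refl) (inj₂ refl) (λ ()) (upperRight-last-boundary G refl) ⟩
    not (M (E-of lastP)) ≡⟨ cong not E-lastTile-matched ⟩
    not (not (even L))   ≡⟨ not-involutive (even L) ⟩
    even L               ∎

  W-firstTile-unmatched : M (W-of (0 , 0)) ≡ false
  W-firstTile-unmatched = trans
    (matched-one-of-two pm (fzero , inj₁ refl) (inj₁ refl) (inj₁ refl) (λ ()) only)
    (cong not m₀)
    where
    only : ∀ {e} → IsBoundary G e → Incident (0 , 0) e → e ≡ S-of (0 , 0) ⊎ e ≡ W-of (0 , 0)
    only {hor _ _} _ (inj₁ refl) = inj₁ refl
    only {ver _ _} _ (inj₁ refl) = inj₂ refl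

W-firstTile-dominant : ∀ ds → DominantFirst (E ∷ ds) (W-of (0 , 0))
W-firstTile-dominant ds = inj₂ refl , only-first
  where
  only-first : ∀ v → Incident v (W-of (0 , 0)) → ∀ j → Corner v (tile (E ∷ ds) j) → j ≡ fzero
  only-first v inc fzero    c = refl
  only-first v inc (fsuc j) c with subst (_ ≤_) (incident-ver inc) (proj₁ (proj₁ (corner-bounds _ c)))
  ... | ()

S-firstTile-not-dominant : ∀ ds → ¬ DominantFirst (E ∷ ds) (S-of (0 , 0))
S-firstTile-not-dominant ds (_ , only-first)
  with only-first (1 , 0) (inj₂ refl) (fsuc fzero) (inj₁ refl)
... | ()

LastTileEdge : Snake → Edge → Set
LastTileEdge G e = e ≡ N-of (tile G (lastTile G)) ⊎ e ≡ E-of (tile G (lastTile G))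

module _ (d : Dir) (ds : List Dir) where

  private
    G = d ∷ ds
    m = length ds
    m≤ : m ≤ length G
    m≤ = n≤1+n m

  tile-lastTile : tile G (lastTile G) ≡ tileAt G (suc m)
  tile-lastTile = cong (tileAt G) (toℕ-fromℕ (suc m))

  earlier-or-lastTile : ∀ (j : Fin (numTiles G)) → toℕ j ≤ m ⊎ j ≡ lastTile G
  earlier-or-lastTile j with m≤n⇒m<n∨m≡n (toℕ≤pred[n] j)
  ... | inj₁ j<  = inj₁ (≤-pred j<)
  ... | inj₂ j≡ = inj₂ (toℕ-injective (trans j≡ (sym (toℕ-fromℕ (suc m)))))

  -- Every corner of an earlier tile is ≼ the upper-right corner of tile m.
  lastTile-dominant : ∀ {e} → LastTileEdge G e →
    (∀ {v} → Incident v e → ¬ v ≼ upperRight (tileAt G m)) → DominantLast G e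
  lastTile-dominant on-last far = on-last , only-last
    where
    only-last : ∀ v → Incident v _ → ∀ j → Corner v (tile G j) → j ≡ lastTile G
    only-last v inc j c with earlier-or-lastTile j
    ... | inj₂ j≡ = j≡
    ... | inj₁ j≤ = ⊥-elim (far inc
            (≼-trans (proj₂ (corner-bounds _ c)) (upperRight-mono (tileAt-mono G j≤))))

  lastTile-not-dominant : ∀ {e} → Incident (upperRight (tileAt G m)) e → ¬ DominantLast G e
  lastTile-not-dominant inc (_ , only-last) = 1+n≰n (≤-reflexive (begin
    suc m                ≡⟨ toℕ-fromℕ (suc m) ⟨
    toℕ (lastTile G)     ≡⟨ cong toℕ (only-last _ inc (tileIndex G m≤) corner) ⟨
    toℕ (tileIndex G m≤) ≡⟨ toℕ-tileIndex G m≤ ⟩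
    m                    ∎))
    where
    corner : Corner (upperRight (tileAt G m)) (tile G (tileIndex G m≤))
    corner = subst (Corner _) (sym (tile-tileIndex G m≤)) (inj₂ (inj₂ (inj₂ refl)))

-- Sign sequences

==ˢ-refl : ∀ x → (x ==ˢ x) ≡ true
==ˢ-refl plus  = refl
==ˢ-refl minus = refl

==ˢ-negˡ : ∀ x z → (neg x ==ˢ z) ≡ not (x ==ˢ z)
==ˢ-negˡ plus  plus  = refl
==ˢ-negˡ plus  minus = refl
==ˢ-negˡ minus plus  = refl
==ˢ-negˡ minus minus = refl

==ˢ-negʳ : ∀ x z → (x ==ˢ neg z) ≡ not (x ==ˢ z)
==ˢ-negʳ plus  plus  = refl
==ˢ-negʳ plus  minus = refl
==ˢ-negʳ minus plus  = refl
==ˢ-negʳ minus minus = refl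

lastOr : Sign → List Sign → Sign
lastOr z []       = z
lastOr z (y ∷ ys) = lastOr y ys

runsFrom-even : ∀ x k ys → even (length (runsFrom x k ys)) ≡ not (x ==ˢ lastOr x ys)
runsFrom-even x     k []           = cong not (sym (==ˢ-refl x))
runsFrom-even plus  k (plus  ∷ ys) = runsFrom-even plus (suc k) ys
runsFrom-even minus k (minus ∷ ys) = runsFrom-even minus (suc k) ys
runsFrom-even plus  k (minus ∷ ys) =
  cong not (trans (runsFrom-even minus 1 ys) (sym (==ˢ-negˡ minus (lastOr minus ys))))
runsFrom-even minus k (plus  ∷ ys) =
  cong not (trans (runsFrom-even plus 1 ys) (sym (==ˢ-negˡ plus (lastOr plus ys))))

negⁿ : ℕ → Sign → Sign
negⁿ zero    s = s
negⁿ (suc n) s = negⁿ n (neg s)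

negⁿ-suc : ∀ n s → negⁿ (suc n) s ≡ neg (negⁿ n s)
negⁿ-suc zero    s = refl
negⁿ-suc (suc n) s = negⁿ-suc n (neg s)

minus-==ˢ-negⁿ : ∀ n → (minus ==ˢ negⁿ n minus) ≡ even n
minus-==ˢ-negⁿ zero    = refl
minus-==ˢ-negⁿ (suc n) = begin
  minus ==ˢ negⁿ (suc n) minus ≡⟨ cong (minus ==ˢ_) (negⁿ-suc n minus) ⟩
  minus ==ˢ neg (negⁿ n minus) ≡⟨ ==ˢ-negʳ minus (negⁿ n minus) ⟩
  not (minus ==ˢ negⁿ n minus) ≡⟨ cong not (minus-==ˢ-negⁿ n) ⟩
  not (even n)                 ∎

nextS≡neg : ∀ d s → nextS d s ≡ neg s
nextS≡neg N s = refl
nextS≡neg E s = refl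

lastOr-signTail : ∀ d ds s f z →
  lastOr z (signTail s f (d ∷ ds)) ≡ sharedSign (dirAt (d ∷ ds) (length ds)) (negⁿ (length ds) s)
lastOr-signTail d []         s f z = refl
lastOr-signTail d (d′ ∷ ds) s f z = begin
  lastOr z (signTail s f (d ∷ d′ ∷ ds))
    ≡⟨ lastOr-signTail d′ ds (nextS d s) (sharedSign d s) (sharedSign d s) ⟩
  sharedSign (dirAt (d′ ∷ ds) (length ds)) (negⁿ (length ds) (nextS d s))
    ≡⟨ cong (sharedSign (dirAt (d′ ∷ ds) (length ds)) ∘ negⁿ (length ds)) (nextS≡neg d s) ⟩
  sharedSign (dirAt (d′ ∷ ds) (length ds)) (negⁿ (length ds) (neg s)) ∎

blockCount : Snake → ℕ
blockCount G = length (blockLengths (signSeq G))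

blockCount-even : ∀ d ds {dₗ} → dirAt (d ∷ ds) (length ds) ≡ dₗ →
  even (blockCount (d ∷ ds)) ≡ not (minus ==ˢ sharedSign dₗ (negⁿ (length ds) minus))
blockCount-even d ds refl =
  trans (runsFrom-even minus 1 (signTail minus minus (d ∷ ds)))
        (cong (λ z → not (minus ==ˢ z)) (lastOr-signTail d ds minus minus minus))

record LastTileSplit (G : Snake) (M : EdgeSet) (b : Bool) : Set where
  field
    dominant other     : Edge
    dominant-dominates : DominantLast G dominant
    other-not-dominant : ¬ DominantLast G other
    other-on-lastTile  : LastTileEdge G other
    lastTile-edges     : ∀ {e} → LastTileEdge G e → e ≡ dominant ⊎ e ≡ other
    M-dominant         : M dominant ≡ not b
    M-other            : M other ≡ b

lastTile-split : ∀ d ds {M} → IsBoundaryPerfectMatching (d ∷ ds) M → M (S-of (0 , 0)) ≡ true →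
  LastTileSplit (d ∷ ds) M (even (blockCount (d ∷ ds)))
lastTile-split d ds {M} pm m₀ with dirAt (d ∷ ds) (length ds) in d≡
... | N = record
  { dominant           = N-of lastP
  ; other              = E-of lastP
  ; dominant-dominates = lastTile-dominant d ds (inj₁ (cong N-of (sym (tile-lastTile d ds)))) far
  ; other-not-dominant = lastTile-not-dominant d ds
      (subst (λ p → Incident (upperRight penP) (E-of p)) (sym lastP≡) (inj₁ refl))
  ; other-on-lastTile  = inj₂ (cong E-of (sym (tile-lastTile d ds)))
  ; lastTile-edges     = λ { (inj₁ e≡) → inj₁ (trans e≡ (cong N-of (tile-lastTile d ds)))
                           ; (inj₂ e≡) → inj₂ (trans e≡ (cong E-of (tile-lastTile d ds))) }
  ; M-dominant         = trans (N-lastTile-matched G pm m₀) (cong not (sym blocks-even))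
  ; M-other            = begin
      M (E-of lastP)      ≡⟨ E-lastTile-matched G pm m₀ ⟩
      not (not (even m))  ≡⟨ not-involutive (even m) ⟩
      even m              ≡⟨ blocks-even ⟨
      even (blockCount G) ∎
  }
  where
  G = d ∷ ds
  m = length ds
  lastP = tileAt G (suc m)
  penP = tileAt G m
  lastP≡ : lastP ≡ move N penP
  lastP≡ = tileAt-next G ≤-refl d≡ refl
  far : ∀ {v} → Incident v (N-of lastP) → ¬ v ≼ upperRight penP
  far inc (_ , y≤) = 1+n≰n
    (subst (_≤ suc (proj₂ penP)) (trans (incident-hor inc) (cong (suc ∘ proj₂) lastP≡)) y≤)
  blocks-even : even (blockCount G) ≡ even m
  blocks-even = begin
    even (blockCount G)                ≡⟨ blockCount-even d ds d≡ ⟩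
    not (minus ==ˢ neg (negⁿ m minus)) ≡⟨ cong not (==ˢ-negʳ minus (negⁿ m minus)) ⟩
    not (not (minus ==ˢ negⁿ m minus)) ≡⟨ not-involutive _ ⟩
    minus ==ˢ negⁿ m minus             ≡⟨ minus-==ˢ-negⁿ m ⟩
    even m                             ∎
... | E = record
  { dominant           = E-of lastP
  ; other              = N-of lastP
  ; dominant-dominates = lastTile-dominant d ds (inj₂ (cong E-of (sym (tile-lastTile d ds)))) far
  ; other-not-dominant = lastTile-not-dominant d ds
      (subst (λ p → Incident (upperRight penP) (N-of p)) (sym lastP≡) (inj₁ refl))
  ; other-on-lastTile  = inj₁ (cong N-of (sym (tile-lastTile d ds)))
  ; lastTile-edges     = λ { (inj₁ e≡) → inj₂ (trans e≡ (cong N-of (tile-lastTile d ds)))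
                           ; (inj₂ e≡) → inj₁ (trans e≡ (cong E-of (tile-lastTile d ds))) }
  ; M-dominant         = trans (E-lastTile-matched G pm m₀) (cong not (sym blocks-even))
  ; M-other            = trans (N-lastTile-matched G pm m₀) (sym blocks-even)
  }
  where
  G = d ∷ ds
  m = length ds
  lastP = tileAt G (suc m)
  penP = tileAt G m
  lastP≡ : lastP ≡ move E penP
  lastP≡ = tileAt-next G ≤-refl d≡ refl
  far : ∀ {v} → Incident v (E-of lastP) → ¬ v ≼ upperRight penP
  far inc (x≤ , _) = 1+n≰n
    (subst (_≤ suc (proj₁ penP)) (trans (incident-ver inc) (cong (suc ∘ proj₁) lastP≡)) x≤)
  blocks-even : even (blockCount G) ≡ not (even m)
  blocks-even = begin
    even (blockCount G)          ≡⟨ blockCount-even d ds d≡ ⟩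
    not (minus ==ˢ negⁿ m minus) ≡⟨ cong not (minus-==ˢ-negⁿ m) ⟩
    not (even m)                 ∎

module BandGluings {G : Snake} {M : EdgeSet} {b : Bool}
  (S-not-dominant : ¬ DominantFirst G (S-of (0 , 0))) (W-dominant : DominantFirst G (W-of (0 , 0)))
  (S-matched : M (S-of (0 , 0)) ≡ true) (W-unmatched : M (W-of (0 , 0)) ≡ false)
  (split : LastTileSplit G M b) where

  open LastTileSplit split

  band-gluing-one-dominant : b ≡ true → ∀ e e′ → IsBandGluing G M e e′ →
    (DominantFirst G e × ¬ DominantLast G e′) ⊎ (¬ DominantFirst G e × DominantLast G e′)
  band-gluing-one-dominant refl e e′ (inj₁ refl , on-last , S⇒e′ , _) with lastTile-edges on-last
  ... | inj₁ refl = inj₂ (S-not-dominant , dominant-dominates)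
  ... | inj₂ refl = contradiction (trans (sym M-other) (S⇒e′ S-matched)) λ ()
  band-gluing-one-dominant refl e e′ (inj₂ refl , on-last , _ , e′⇒W) with lastTile-edges on-last
  ... | inj₁ refl = contradiction (trans (sym (e′⇒W M-dominant)) W-unmatched) λ ()
  ... | inj₂ refl = inj₁ (W-dominant , other-not-dominant)

  band-gluing-none-dominant : b ≡ false →
    Σ Edge λ e → Σ Edge λ e′ → IsBandGluing G M e e′ × ¬ DominantFirst G e × ¬ DominantLast G e′
  band-gluing-none-dominant refl =
    S-of (0 , 0) , other , (inj₁ refl , other-on-lastTile , (λ _ → M-other) , (λ _ → S-matched)) ,
    S-not-dominant , other-not-dominant

  band-gluing-both-dominant : b ≡ false →
    Σ Edge λ e → Σ Edge λ e′ → IsBandGluing G M e e′ × DominantFirst G e × DominantLast G e′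
  band-gluing-both-dominant refl =
    W-of (0 , 0) , dominant ,
    (inj₂ refl , proj₁ dominant-dominates ,
      (λ W-matched → contradiction (trans (sym W-matched) W-unmatched) λ ()) ,
      (λ dominant-unmatched → contradiction (trans (sym M-dominant) dominant-unmatched) λ ())) ,
    W-dominant , dominant-dominates

corollary5p3 :
    (G : Snake) (as : List ℕ) → IsSnakeOf G as →
    1 ≤ length G →
    (a₁ aₙ : ℕ) → head as ≡ just a₁ → last as ≡ just aₙ → 1 < a₁ → 1 < aₙ →
    (M : EdgeSet) → IsMinimalMatching G M →
    (length as % 2 ≡ 0 →
      ∀ e e' → IsBandGluing G M e e' →
        (DominantFirst G e × ¬ DominantLast G e') ⊎ (¬ DominantFirst G e × DominantLast G e'))
    ×
    (length as % 2 ≡ 1 →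
      (Σ Edge λ e → Σ Edge λ e' → IsBandGluing G M e e' × ¬ DominantFirst G e × ¬ DominantLast G e')
      ×
      (Σ Edge λ e → Σ Edge λ e' → IsBandGluing G M e e' × DominantFirst G e × DominantLast G e'))
corollary5p3 []       _ _    () _ _ _    _ _        _ _ _
-- Gluing G₂ north of G₁ makes a₁ = 1.
corollary5p3 (N ∷ ds) _ refl _  _ _ refl _ (s≤s ()) _ _ _
corollary5p3 (E ∷ ds) _ refl _  _ _ _    _ _        _ M (pm , m₀) =
  (λ h → band-gluing-one-dominant (n%2≡0⇒even n h)) ,
  (λ h → band-gluing-none-dominant (n%2≡1⇒odd n h) , band-gluing-both-dominant (n%2≡1⇒odd n h))
  where
  n = blockCount (E ∷ ds)
  open BandGluings (S-firstTile-not-dominant ds) (W-firstTile-dominant ds)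
    m₀ (W-firstTile-unmatched (E ∷ ds) pm m₀) (lastTile-split E ds pm m₀)
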